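{- Let $n \geq 2$ and let $v_1, \dots, v_{2^{n-1}} \in \mathbb{F}_2^n$ be nonzero vectors such that $v_{2i-1} = v_{2i}$ for all $1 \leq i \leq 2^{n-2}$ and $\dim(\mathrm{span}\{v_1, \dots, v_{2^{n-1}}\}) \leq n/2$. Then there exist vectors $p_1, q_1, \dots, p_{2^{n-1}}, q_{2^{n-1}}$ forming exactly the $2^n$ elements of $\mathbb{F}_2^n$ (each once) with $p_i + q_i = v_i$ for all $1 \leq i \leq 2^{n-1}$. -}

module Defs where

open import Data.Bool using (Bool; true; false; _xor_; if_then_else_)
open import Data.Nat using (ℕ; zero; suc; _*_; _≤_)
open import Data.Fin using (Fin; zero; suc)
open import Data.Vec using (Vec; zipWith; replicate)
open import Data.Product using (Σ; ∃; _×_)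
open import Relation.Binary.PropositionalEquality using (_≡_)

F2^ : ℕ → Set
F2^ n = Vec Bool n

𝟎 : ∀ {n} → F2^ n
𝟎 {n} = replicate n false

_⊕_ : ∀ {n} → F2^ n → F2^ n → F2^ n
_⊕_ = zipWith _xor_

infixl 6 _⊕_

_·_ : ∀ {n} → Bool → F2^ n → F2^ n
c · x = if c then x else 𝟎

lincomb : ∀ {n} d → (Fin d → Bool) → (Fin d → F2^ n) → F2^ n
lincomb zero    c w = 𝟎
lincomb (suc d) c w = (c zero · w zero) ⊕ lincomb d (λ i → c (suc i)) (λ i → w (suc i))

InSpan : ∀ {n d} → (Fin d → F2^ n) → F2^ n → Set
InSpan {n} {d} w x = Σ (Fin d → Bool) λ c → lincomb d c w ≡ x

-- dim span{v_i : i ∈ Fin m} ≤ k : the span of v is contained in the span of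
-- some k vectors (equivalently, the span has dimension at most k)
DimSpan≤ : ∀ {n m} → (Fin m → F2^ n) → ℕ → Set
DimSpan≤ {n} {m} v k = Σ (Fin k → F2^ n) λ w → ∀ i → InSpan w (v i)

-- Given nonzero v₁, …, v_{2ⁿ⁻¹} ∈ 𝔽₂ⁿ with v_{2k-1} = v_{2k} whose span has dimension d ≤ n/2,
-- we split 𝔽₂ⁿ into pairs {pᵢ, qᵢ} with pᵢ ⊕ qᵢ = vᵢ.
--  1. Gaussian elimination by transvections gives an automorphism A of 𝔽₂ⁿ moving every vᵢ
--     into 𝔽₂ᵈ × 0, and a pairing for A ∘ v pulls back along A⁻¹.
--  2. If d = 1, every A vᵢ is the first unit vector and the pairs {(0, x), (1, x)} work.
--  3. If d ≥ 2, write n = d + e with d ≤ e.  The 2ⁿ⁻² values uₖ of the pairs of equal vᵢ are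
--     packed by the alias method into 2ᵉ bins of 2ᵈ⁻² slots with at most two distinct values
--     per bin (there are at most 2ᵈ ≤ 2ᵉ values).  Bin g is the fibre 𝔽₂ᵈ × {g}; a second
--     elimination moves the two values of the bin into 𝔽₂² × 0, and each slot, a coset of
--     𝔽₂² × 0, is split into two pairs of difference uₖ, one for each index of the pair.
--  4. The 2ⁿ points obtained are distinct, so by counting they exhaust 𝔽₂ⁿ.

module Submission where

open import Defs
open import Data.Bool using (Bool; true; false; _xor_; _∧_; if_then_else_)
open import Data.Bool.Properties using (xor-assoc; xor-comm; xor-identityˡ; xor-identityʳ; xor-same) renaming (_≟_ to _≟ᵇ_)
open import Data.Empty using (⊥; ⊥-elim)
open import Data.Fin using (Fin; zero; suc; toℕ; fromℕ<; cast; combine; remQuot; punchOut; splitAt; join; _↑ˡ_; _↑ʳ_)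
open import Data.Fin.Properties using (toℕ-fromℕ<; toℕ-injective; toℕ<n; toℕ-cast; toℕ-combine; combine-remQuot; remQuot-combine; any?; injective⇒≤; punchOut-injective; join-splitAt; ↑ˡ-injective; ↑ʳ-injective; splitAt-↑ˡ; splitAt-↑ʳ) renaming (_≟_ to _≟ᶠ_)
open import Data.Nat using (ℕ; zero; suc; _+_; _*_; _∸_; _^_; _≤_; _<_; _<?_; _≤?_; _≟_; z≤n; s≤s; s≤s⁻¹; z<s)
open import Data.Nat.Properties using (+-*-semiring; ≤-refl; ≤-trans; ≤-reflexive; <-irrefl; <-trans; <-≤-trans; <-cmp; <⇒≤; ≮⇒≥; ≰⇒>; ≤∧≢⇒<; ≤-pred; n≤1+n; n<1+n; n≤0⇒n≡0; m≤m+n; m≤n+m; +-comm; +-identityʳ; +-mono-≤; +-mono-<-≤; +-mono-≤-<; +-monoʳ-<; +-cancelˡ-≡; +-cancelˡ-<; m∸n≤m; m+[n∸m]≡n; m≤n⇒m∸n≡0; ∸-cancelʳ-≡; m+n≤o⇒m≤o; m+n≤o⇒m≤o∸n; *-comm; *-identityʳ; *-zeroʳ; *-monoʳ-≤; *-monoˡ-<; *-cancelˡ-<; ^-distribˡ-+-*; ^-monoʳ-≤; m^n>0; module ≤-Reasoning)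
open import Algebra.Properties.Semiring.Sum +-*-semiring using (sum; ∑-comm; ∑-distrib-+; *-distribˡ-sum; sum-cong-≗)
open import Data.Product using (Σ; _×_; _,_; proj₁; proj₂; uncurry)
open import Data.Product.Properties using (,-injective)
open import Data.Sum using (_⊎_; inj₁; inj₂; [_,_])
import Data.Sum as Sum
open import Data.Vec using ([]; _∷_; _++_; lookup; tabulate; take)
open import Data.Vec.Properties using (∷-injective; lookup-zipWith; lookup-replicate; lookup∘tabulate; zipWith-assoc; zipWith-comm; zipWith-identityˡ; zipWith-identityʳ; zipWith-++; ++-injectiveˡ; ++-injectiveʳ)
import Data.Vec.Functional as Vector
open import Data.Vec.Functional.Properties using (lookup-++ˡ; lookup-++ʳ)
open import Function.Definitions using (Injective; Bijective)
open import Relation.Binary.Definitions using (tri<; tri≈; tri>)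
open import Relation.Binary.PropositionalEquality using (_≡_; _≢_; refl; sym; trans; cong; cong₂; subst; subst₂; module ≡-Reasoning)
open import Relation.Nullary using (Dec; yes; no; does; ¬_)
open import Relation.Nullary.Decidable using (_×-dec_; dec-true; dec-false)

⊕-assoc : ∀ {n} (x y z : F2^ n) → (x ⊕ y) ⊕ z ≡ x ⊕ (y ⊕ z)
⊕-assoc = zipWith-assoc xor-assoc

⊕-comm : ∀ {n} (x y : F2^ n) → x ⊕ y ≡ y ⊕ x
⊕-comm = zipWith-comm xor-comm

⊕-identityˡ : ∀ {n} (x : F2^ n) → 𝟎 ⊕ x ≡ x
⊕-identityˡ = zipWith-identityˡ xor-identityˡ

⊕-identityʳ : ∀ {n} (x : F2^ n) → x ⊕ 𝟎 ≡ x
⊕-identityʳ = zipWith-identityʳ xor-identityʳ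

⊕-self : ∀ {n} (x : F2^ n) → x ⊕ x ≡ 𝟎
⊕-self []      = refl
⊕-self (a ∷ x) = cong₂ _∷_ (xor-same a) (⊕-self x)

⊕-cancel : ∀ {n} (x y : F2^ n) → (x ⊕ y) ⊕ y ≡ x
⊕-cancel x y = begin
  (x ⊕ y) ⊕ y  ≡⟨ ⊕-assoc x y y ⟩
  x ⊕ (y ⊕ y)  ≡⟨ cong (x ⊕_) (⊕-self y) ⟩
  x ⊕ 𝟎        ≡⟨ ⊕-identityʳ x ⟩
  x            ∎
  where open ≡-Reasoning

⊕-interchange : ∀ {n} (a b c d : F2^ n) → (a ⊕ b) ⊕ (c ⊕ d) ≡ (a ⊕ c) ⊕ (b ⊕ d)
⊕-interchange a b c d = begin
  (a ⊕ b) ⊕ (c ⊕ d)  ≡⟨ ⊕-assoc a b (c ⊕ d) ⟩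
  a ⊕ (b ⊕ (c ⊕ d))  ≡⟨ cong (a ⊕_) (sym (⊕-assoc b c d)) ⟩
  a ⊕ ((b ⊕ c) ⊕ d)  ≡⟨ cong (λ h → a ⊕ (h ⊕ d)) (⊕-comm b c) ⟩
  a ⊕ ((c ⊕ b) ⊕ d)  ≡⟨ cong (a ⊕_) (⊕-assoc c b d) ⟩
  a ⊕ (c ⊕ (b ⊕ d))  ≡⟨ sym (⊕-assoc a c (b ⊕ d)) ⟩
  (a ⊕ c) ⊕ (b ⊕ d)  ∎
  where open ≡-Reasoning

pair-difference : ∀ {n} (a c : F2^ n) → (a ⊕ 𝟎) ⊕ (a ⊕ c) ≡ c
pair-difference a c = begin
  (a ⊕ 𝟎) ⊕ (a ⊕ c)  ≡⟨ ⊕-interchange a 𝟎 a c ⟩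
  (a ⊕ a) ⊕ (𝟎 ⊕ c)  ≡⟨ cong₂ _⊕_ (⊕-self a) (⊕-identityˡ c) ⟩
  𝟎 ⊕ c              ≡⟨ ⊕-identityˡ c ⟩
  c                  ∎
  where open ≡-Reasoning

⊕-++ : ∀ {k e} (a c : F2^ k) (b d : F2^ e) → (a ++ b) ⊕ (c ++ d) ≡ (a ⊕ c) ++ (b ⊕ d)
⊕-++ a c b d = zipWith-++ _xor_ a b c d

𝟎-++ : ∀ {k e} → 𝟎 {k} ++ 𝟎 {e} ≡ 𝟎
𝟎-++ {zero}  = refl
𝟎-++ {suc k} = cong (false ∷_) (𝟎-++ {k})

lookup-⊕ : ∀ {n} (x y : F2^ n) i → lookup (x ⊕ y) i ≡ lookup x i xor lookup y i
lookup-⊕ x y i = lookup-zipWith _xor_ i x y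

lookup-𝟎 : ∀ {n} (i : Fin n) → lookup (𝟎 {n}) i ≡ false
lookup-𝟎 i = lookup-replicate i false

lookup-· : ∀ {n} c (x : F2^ n) i → lookup (c · x) i ≡ c ∧ lookup x i
lookup-· true  x i = refl
lookup-· false x i = lookup-𝟎 i

·-distrib-xor : ∀ {n} a b (z : F2^ n) → (a xor b) · z ≡ (a · z) ⊕ (b · z)
·-distrib-xor false b z = sym (⊕-identityˡ (b · z))
·-distrib-xor true false z = sym (⊕-identityʳ z)
·-distrib-xor true true z = sym (⊕-self z)

record LinAut (N : ℕ) : Set where
  field
    to      : F2^ N → F2^ N
    from    : F2^ N → F2^ N
    to-from : ∀ x → to (from x) ≡ x
    from-to : ∀ x → from (to x) ≡ x
    to-⊕    : ∀ x y → to (x ⊕ y) ≡ to x ⊕ to y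

module LinAutProperties {N} (A : LinAut N) where
  open ≡-Reasoning
  open LinAut A

  from-⊕ : ∀ x y → from (x ⊕ y) ≡ from x ⊕ from y
  from-⊕ x y = begin
    from (x ⊕ y)                      ≡⟨ cong from (cong₂ _⊕_ (sym (to-from x)) (sym (to-from y))) ⟩
    from (to (from x) ⊕ to (from y))  ≡⟨ cong from (sym (to-⊕ (from x) (from y))) ⟩
    from (to (from x ⊕ from y))       ≡⟨ from-to (from x ⊕ from y) ⟩
    from x ⊕ from y                   ∎

  to-𝟎 : to 𝟎 ≡ 𝟎
  to-𝟎 = begin
    to 𝟎              ≡⟨ cong to (sym (⊕-self 𝟎)) ⟩
    to (𝟎 ⊕ 𝟎)        ≡⟨ to-⊕ 𝟎 𝟎 ⟩
    to 𝟎 ⊕ to 𝟎       ≡⟨ ⊕-self (to 𝟎) ⟩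
    𝟎                 ∎

  to-injective : ∀ {x y} → to x ≡ to y → x ≡ y
  to-injective {x} {y} eq = trans (sym (from-to x)) (trans (cong from eq) (from-to y))

  from-injective : ∀ {x y} → from x ≡ from y → x ≡ y
  from-injective {x} {y} eq = trans (sym (to-from x)) (trans (cong to eq) (to-from y))

  to-· : ∀ c x → to (c · x) ≡ c · to x
  to-· true  x = refl
  to-· false x = to-𝟎

  to-lincomb : ∀ d c (w : Fin d → F2^ N) → to (lincomb d c w) ≡ lincomb d c (λ j → to (w j))
  to-lincomb zero    c w = to-𝟎
  to-lincomb (suc d) c w =
    trans (to-⊕ _ _) (cong₂ _⊕_ (to-· (c zero) (w zero)) (to-lincomb d (λ j → c (suc j)) (λ j → w (suc j))))

idᴬ : ∀ {N} → LinAut N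
idᴬ = record { to = λ x → x ; from = λ x → x ; to-from = λ _ → refl ; from-to = λ _ → refl ; to-⊕ = λ _ _ → refl }

_∘ᴬ_ : ∀ {N} → LinAut N → LinAut N → LinAut N
B ∘ᴬ A = record
  { to      = λ x → B.to (A.to x)
  ; from    = λ x → A.from (B.from x)
  ; to-from = λ x → trans (cong B.to (A.to-from (B.from x))) (B.to-from x)
  ; from-to = λ x → trans (cong A.from (B.from-to (A.to x))) (A.from-to x)
  ; to-⊕    = λ x y → trans (cong B.to (A.to-⊕ x y)) (B.to-⊕ (A.to x) (A.to y))
  }
  where module A = LinAut A
        module B = LinAut B

τ : ∀ {N} → Fin N → F2^ N → F2^ N → F2^ N
τ t z x = x ⊕ (lookup x t · z)

τ-fix : ∀ {N} t (z x : F2^ N) → lookup x t ≡ false → τ t z x ≡ x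
τ-fix t z x xₜ≡0 = trans (cong (λ b → x ⊕ (b · z)) xₜ≡0) (⊕-identityʳ x)

τ-hit : ∀ {N} t (z x : F2^ N) → lookup x t ≡ true → τ t z x ≡ x ⊕ z
τ-hit t z x xₜ≡1 = cong (λ b → x ⊕ (b · z)) xₜ≡1

τ-⊕ : ∀ {N} t (z : F2^ N) x y → τ t z (x ⊕ y) ≡ τ t z x ⊕ τ t z y
τ-⊕ t z x y = begin
  (x ⊕ y) ⊕ (lookup (x ⊕ y) t · z)                 ≡⟨ cong (λ b → (x ⊕ y) ⊕ (b · z)) (lookup-⊕ x y t) ⟩
  (x ⊕ y) ⊕ ((lookup x t xor lookup y t) · z)      ≡⟨ cong ((x ⊕ y) ⊕_) (·-distrib-xor (lookup x t) (lookup y t) z) ⟩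
  (x ⊕ y) ⊕ ((lookup x t · z) ⊕ (lookup y t · z))  ≡⟨ ⊕-interchange x y _ _ ⟩
  τ t z x ⊕ τ t z y                                ∎
  where open ≡-Reasoning

-- τ does not change the t-th coordinate, hence is an involution
τ-involutive : ∀ {N} t (z : F2^ N) → lookup z t ≡ false → ∀ x → τ t z (τ t z x) ≡ x
τ-involutive t z zₜ≡0 x = begin
  τ t z x ⊕ (lookup (τ t z x) t · z)         ≡⟨ cong (λ b → τ t z x ⊕ (b · z)) coordinate-t ⟩
  (x ⊕ (lookup x t · z)) ⊕ (lookup x t · z)  ≡⟨ ⊕-cancel x _ ⟩
  x                                          ∎
  where
  open ≡-Reasoning
  coordinate-t : lookup (τ t z x) t ≡ lookup x t
  coordinate-t = begin
    lookup (τ t z x) t                            ≡⟨ lookup-⊕ x _ t ⟩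
    lookup x t xor lookup (lookup x t · z) t      ≡⟨ cong (lookup x t xor_) (lookup-· (lookup x t) z t) ⟩
    lookup x t xor (lookup x t ∧ lookup z t)      ≡⟨ cong (λ b → lookup x t xor (lookup x t ∧ b)) zₜ≡0 ⟩
    lookup x t xor (lookup x t ∧ false)           ≡⟨ xor-∧false (lookup x t) ⟩
    lookup x t                                    ∎
    where xor-∧false : ∀ b → b xor (b ∧ false) ≡ b
          xor-∧false false = refl
          xor-∧false true  = refl

transvection : ∀ {N} (t : Fin N) (z : F2^ N) → lookup z t ≡ false → LinAut N
transvection t z zₜ≡0 = record
  { to = τ t z ; from = τ t z
  ; to-from = τ-involutive t z zₜ≡0 ; from-to = τ-involutive t z zₜ≡0
  ; to-⊕ = τ-⊕ t z }

Supported : ∀ {N} → ℕ → F2^ N → Set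
Supported {N} k x = ∀ (i : Fin N) → k ≤ toℕ i → lookup x i ≡ false

Supported-suc : ∀ {N k} {x : F2^ N} → Supported k x → Supported (suc k) x
Supported-suc sx i k<i = sx i (≤-trans (n≤1+n _) k<i)

Supported-lincomb : ∀ {N k} d c (w : Fin d → F2^ N) → (∀ j → Supported k (w j)) → Supported k (lincomb d c w)
Supported-lincomb zero    c w sw i _ = lookup-𝟎 i
Supported-lincomb {N} (suc d) c w sw i k≤i = begin
  lookup ((c zero · w zero) ⊕ rest) i              ≡⟨ lookup-⊕ (c zero · w zero) rest i ⟩
  lookup (c zero · w zero) i xor lookup rest i     ≡⟨ cong₂ _xor_ (lookup-· (c zero) (w zero) i) (Supported-lincomb d _ _ (λ j → sw (suc j)) i k≤i) ⟩
  (c zero ∧ lookup (w zero) i) xor false           ≡⟨ cong (λ b → (c zero ∧ b) xor false) (sw zero i k≤i) ⟩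
  (c zero ∧ false) xor false                       ≡⟨ ∧false (c zero) ⟩
  false                                            ∎
  where
  open ≡-Reasoning
  rest : F2^ N
  rest = lincomb d (λ j → c (suc j)) (λ j → w (suc j))
  ∧false : ∀ b → (b ∧ false) xor false ≡ false
  ∧false false = refl
  ∧false true  = refl

Supported-zero : ∀ {N} {x : F2^ N} → Supported 0 x → x ≡ 𝟎
Supported-zero {x = []}    sx = refl
Supported-zero {x = a ∷ x} sx = cong₂ _∷_ (sx zero z≤n) (Supported-zero (λ i _ → sx (suc i) z≤n))

Supported-split : ∀ k {e} (x : F2^ (k + e)) → Supported k x → x ≡ take k x ++ 𝟎 {e}
Supported-split zero    x       sx = Supported-zero sx
Supported-split (suc k) (a ∷ x) sx = cong (a ∷_) (Supported-split k x (λ i k≤i → sx (suc i) (s≤s k≤i)))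

-- One pivot step: an automorphism fixing 𝔽₂ᵏ × 0 that moves a
-- given y into 𝔽₂ᵏ⁺¹ × 0.  If y has a nonzero coordinate i₀ ≥ k, a first transvection
-- makes coordinate k of y nonzero, and a second one clears the coordinates above k.

unit : ∀ {N} → Fin N → F2^ N
unit c = tabulate (λ i → does (i ≟ᶠ c))

above : ∀ {N} → ℕ → F2^ N → F2^ N
above k y = tabulate (λ i → does (k <? toℕ i) ∧ lookup y i)

clear-above : ∀ {N} (c : Fin N) (y : F2^ N) → lookup y c ≡ true →
              Σ (LinAut N) λ B → (∀ x → lookup x c ≡ false → LinAut.to B x ≡ x) × Supported (suc (toℕ c)) (LinAut.to B y)
clear-above {N} c y y꜀≡1 = transvection c z z꜀≡0 , (λ x x꜀≡0 → τ-fix c z x x꜀≡0) , cleared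
  where
  open ≡-Reasoning
  z : F2^ N
  z = above (toℕ c) y
  z꜀≡0 : lookup z c ≡ false
  z꜀≡0 = trans (lookup∘tabulate _ c) (cong (_∧ lookup y c) (dec-false (toℕ c <? toℕ c) (<-irrefl refl)))
  cleared : Supported (suc (toℕ c)) (τ c z y)
  cleared i c<i = begin
    lookup (τ c z y) i                                     ≡⟨ cong (λ v → lookup v i) (τ-hit c z y y꜀≡1) ⟩
    lookup (y ⊕ z) i                                       ≡⟨ lookup-⊕ y z i ⟩
    lookup y i xor lookup z i                              ≡⟨ cong (lookup y i xor_) (lookup∘tabulate _ i) ⟩
    lookup y i xor (does (toℕ c <? toℕ i) ∧ lookup y i)    ≡⟨ cong (λ b → lookup y i xor (b ∧ lookup y i)) (dec-true (toℕ c <? toℕ i) c<i) ⟩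
    lookup y i xor lookup y i                              ≡⟨ xor-same (lookup y i) ⟩
    false                                                  ∎

raise-pivot : ∀ {N} (c i₀ : Fin N) (y : F2^ N) → lookup y i₀ ≡ true →
              Σ (LinAut N) λ B → (∀ x → lookup x i₀ ≡ false → LinAut.to B x ≡ x) × lookup (LinAut.to B y) c ≡ true
raise-pivot c i₀ y y₀≡1 with lookup y c in y꜀
... | true  = idᴬ , (λ _ _ → refl) , y꜀
... | false = transvection i₀ (unit c) unitᵢ₀≡0 , (λ x xᵢ₀≡0 → τ-fix i₀ (unit c) x xᵢ₀≡0) , raised
  where
  open ≡-Reasoning
  i₀≢c : i₀ ≢ c
  i₀≢c refl with () ← trans (sym y₀≡1) y꜀
  unitᵢ₀≡0 : lookup (unit c) i₀ ≡ false
  unitᵢ₀≡0 = trans (lookup∘tabulate _ i₀) (dec-false (i₀ ≟ᶠ c) i₀≢c)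
  raised : lookup (τ i₀ (unit c) y) c ≡ true
  raised = begin
    lookup (τ i₀ (unit c) y) c          ≡⟨ cong (λ v → lookup v c) (τ-hit i₀ (unit c) y y₀≡1) ⟩
    lookup (y ⊕ unit c) c               ≡⟨ lookup-⊕ y (unit c) c ⟩
    lookup y c xor lookup (unit c) c    ≡⟨ cong₂ _xor_ y꜀ (lookup∘tabulate _ c) ⟩
    does (c ≟ᶠ c)                       ≡⟨ dec-true (c ≟ᶠ c) refl ⟩
    true                                ∎

pivot-step : ∀ {N k} (c : Fin N) → toℕ c ≡ k → (y : F2^ N) →
             Σ (LinAut N) λ B → (∀ x → Supported k x → LinAut.to B x ≡ x) × Supported (suc k) (LinAut.to B y)
pivot-step c refl y with any? (λ i → (toℕ c ≤? toℕ i) ×-dec (lookup y i ≟ᵇ true))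
... | no no-pivot = idᴬ , (λ _ _ → refl) , y-supported
  where
  y-supported : Supported (suc (toℕ c)) y
  y-supported i c<i with lookup y i in yᵢ
  ... | false = refl
  ... | true  = ⊥-elim (no-pivot (i , ≤-trans (n≤1+n (toℕ c)) c<i , yᵢ))
... | yes (i₀ , c≤i₀ , y₀≡1) with raise-pivot c i₀ y y₀≡1
... | B₁ , B₁-fixes , raised with clear-above c (LinAut.to B₁ y) raised
... | B₂ , B₂-fixes , cleared = B₂ ∘ᴬ B₁ , fixes , cleared
  where
  fixes : ∀ x → Supported (toℕ c) x → LinAut.to B₂ (LinAut.to B₁ x) ≡ x
  fixes x sx = trans (cong (LinAut.to B₂) (B₁-fixes x (sx i₀ c≤i₀))) (B₂-fixes x (sx c ≤-refl))

-- Only this specification is used later; the construction is kept opaque so that type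
-- checking never unfolds the elimination.
opaque
  straighten : ∀ {N} k (w : Fin k → F2^ N) → k ≤ N → Σ (LinAut N) λ A → ∀ j → Supported k (LinAut.to A (w j))
  straighten zero    w _   = idᴬ , λ ()
  straighten {N} (suc k) w k<N = B ∘ᴬ A , supported
    where
    rest : Σ (LinAut N) λ A → ∀ j → Supported k (LinAut.to A (w (suc j)))
    rest = straighten k (λ j → w (suc j)) (≤-trans (n≤1+n k) k<N)
    A : LinAut N
    A = proj₁ rest
    step : Σ (LinAut N) λ B → (∀ x → Supported k x → LinAut.to B x ≡ x) × Supported (suc k) (LinAut.to B (LinAut.to A (w zero)))
    step = pivot-step (fromℕ< k<N) (toℕ-fromℕ< k<N) (LinAut.to A (w zero))
    B : LinAut N
    B = proj₁ step
    supported : ∀ j → Supported (suc k) (LinAut.to B (LinAut.to A (w j)))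
    supported zero    = proj₂ (proj₂ step)
    supported (suc j) = subst (Supported (suc k)) (sym (proj₁ (proj₂ step) x (proj₂ rest j))) (Supported-suc {x = x} (proj₂ rest j))
      where x : F2^ N
            x = LinAut.to A (w (suc j))

straighten-span : ∀ {N m d} (v : Fin m → F2^ N) → DimSpan≤ v d → d ≤ N →
                  Σ (LinAut N) λ A → ∀ i → Supported d (LinAut.to A (v i))
straighten-span {N} {d = d} v (w , w-spans) d≤N = A , supported
  where
  A : LinAut N
  A = proj₁ (straighten d w d≤N)
  supported : ∀ i → Supported d (LinAut.to A (v i))
  supported i with w-spans i
  ... | c , lincomb≡vᵢ = subst (λ x → Supported d (LinAut.to A x)) lincomb≡vᵢ
    (subst (Supported d) (sym (LinAutProperties.to-lincomb A d c w))
      (Supported-lincomb d c (λ j → LinAut.to A (w j)) (proj₂ (straighten d w d≤N))))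

bitᶠ : Bool → Fin 2
bitᶠ false = zero
bitᶠ true  = suc zero

unbit : Fin 2 → Bool
unbit zero       = false
unbit (suc zero) = true

unbit-injective : ∀ {s t : Fin 2} → unbit s ≡ unbit t → s ≡ t
unbit-injective {zero}     {zero}     _ = refl
unbit-injective {suc zero} {suc zero} _ = refl
unbit-injective {zero}     {suc zero} ()
unbit-injective {suc zero} {zero}     ()

encode : ∀ {k} → F2^ k → Fin (2 ^ k)
encode []      = zero
encode (b ∷ x) = combine (bitᶠ b) (encode x)

decode : ∀ {k} → Fin (2 ^ k) → F2^ k
decode {zero}  _ = []
decode {suc k} i = unbit (proj₁ (remQuot {2} (2 ^ k) i)) ∷ decode {k} (proj₂ (remQuot {2} (2 ^ k) i))

decode-encode : ∀ {k} (x : F2^ k) → decode (encode x) ≡ x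
decode-encode []      = refl
decode-encode {suc k} (b ∷ x) = cong₂ _∷_
    (trans (cong (λ p → unbit (proj₁ p)) split) (unbit-bitᶠ b))
    (trans (cong (λ p → decode {k} (proj₂ p)) split) (decode-encode x))
  where split : remQuot {2} (2 ^ k) (combine (bitᶠ b) (encode x)) ≡ (bitᶠ b , encode x)
        split = remQuot-combine (bitᶠ b) (encode x)
        unbit-bitᶠ : ∀ b → unbit (bitᶠ b) ≡ b
        unbit-bitᶠ false = refl
        unbit-bitᶠ true  = refl

encode-decode : ∀ {k} (i : Fin (2 ^ k)) → encode (decode {k} i) ≡ i
encode-decode {zero}  zero = refl
encode-decode {suc k} i = begin
  combine (bitᶠ (unbit s)) (encode (decode {k} j))  ≡⟨ cong₂ combine (bitᶠ-unbit s) (encode-decode {k} j) ⟩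
  combine s j                                       ≡⟨ combine-remQuot {2} (2 ^ k) i ⟩
  i                                                 ∎
  where
  open ≡-Reasoning
  s : Fin 2
  s = proj₁ (remQuot {2} (2 ^ k) i)
  j : Fin (2 ^ k)
  j = proj₂ (remQuot {2} (2 ^ k) i)
  bitᶠ-unbit : ∀ t → bitᶠ (unbit t) ≡ t
  bitᶠ-unbit zero       = refl
  bitᶠ-unbit (suc zero) = refl

encode-injective : ∀ {k} {x y : F2^ k} → encode x ≡ encode y → x ≡ y
encode-injective {k} {x} {y} eq = trans (sym (decode-encode x)) (trans (cong (decode {k}) eq) (decode-encode y))

decode-injective : ∀ {k} {i j : Fin (2 ^ k)} → decode {k} i ≡ decode j → i ≡ j
decode-injective {k} {i} {j} eq = trans (sym (encode-decode {k} i)) (trans (cong encode eq) (encode-decode {k} j))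

injective⇒surjective : ∀ {n} (f : Fin n → Fin n) → Injective _≡_ _≡_ f → ∀ y → Σ (Fin n) λ x → f x ≡ y
injective⇒surjective {suc n} f f-inj y with any? (λ x → f x ≟ᶠ y)
... | yes hit = hit
... | no miss = ⊥-elim (<-irrefl refl (injective⇒≤ g-inj))
  where
  y≢f : ∀ x → y ≢ f x
  y≢f x y≡fx = miss (x , sym y≡fx)
  g : Fin (suc n) → Fin n
  g x = punchOut (y≢f x)
  g-inj : Injective _≡_ _≡_ g
  g-inj eq = f-inj (punchOut-injective (y≢f _) (y≢f _) eq)

points-bijective : ∀ {n M} (P : Fin M ⊎ Fin M → F2^ n) → M + M ≡ 2 ^ n → Injective _≡_ _≡_ P → Bijective _≡_ _≡_ P
points-bijective {n} {M} P M+M≡2ⁿ P-inj = P-inj , surjective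
  where
  open ≡-Reasoning
  index : Fin (2 ^ n) → Fin M ⊎ Fin M
  index i = splitAt M (cast (sym M+M≡2ⁿ) i)
  index-injective : Injective _≡_ _≡_ index
  index-injective {i} {j} eq = toℕ-injective (begin
    toℕ i                        ≡⟨ sym (toℕ-cast (sym M+M≡2ⁿ) i) ⟩
    toℕ (cast (sym M+M≡2ⁿ) i)    ≡⟨ cong toℕ (trans (sym (join-splitAt M M _)) (trans (cong (join M M) eq) (join-splitAt M M _))) ⟩
    toℕ (cast (sym M+M≡2ⁿ) j)    ≡⟨ toℕ-cast (sym M+M≡2ⁿ) j ⟩
    toℕ j                        ∎)
  h : Fin (2 ^ n) → Fin (2 ^ n)
  h i = encode (P (index i))
  surjective : ∀ x → Σ (Fin M ⊎ Fin M) λ a → ∀ {a′} → a′ ≡ a → P a′ ≡ x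
  surjective x with injective⇒surjective h (λ eq → index-injective (P-inj (encode-injective eq))) (encode x)
  ... | i , hᵢ≡x = index i , λ { refl → encode-injective hᵢ≡x }

record Pairing {N M} (y : Fin M → F2^ N) : Set where
  field
    point            : Fin M → Bool → F2^ N
    point-injective  : ∀ {i b j c} → point i b ≡ point j c → i ≡ j × b ≡ c
    point-difference : ∀ i → point i false ⊕ point i true ≡ y i

pairing-pullback : ∀ {N M} (A : LinAut N) (v : Fin M → F2^ N) → Pairing (λ i → LinAut.to A (v i)) → Pairing v
pairing-pullback A v P = record
  { point            = λ i b → from (point i b)
  ; point-injective  = λ eq → point-injective (from-injective eq)
  ; point-difference = λ i → trans (sym (from-⊕ _ _)) (trans (cong from (point-difference i)) (from-to (v i)))
  }
  where open Pairing P
        open LinAut A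
        open LinAutProperties A

pairing-bijective : ∀ {N M} {y : Fin M → F2^ N} → M + M ≡ 2 ^ N → (P : Pairing y) →
                    Bijective _≡_ _≡_ [ (λ i → Pairing.point P i false) , (λ i → Pairing.point P i true) ]
pairing-bijective {N} {M} M+M≡2ᴺ P = points-bijective endpoints M+M≡2ᴺ injective
  where
  open Pairing P
  endpoints : Fin M ⊎ Fin M → F2^ N
  endpoints = [ (λ i → point i false) , (λ i → point i true) ]
  injective : Injective _≡_ _≡_ endpoints
  injective {inj₁ i} {inj₁ j} eq = cong inj₁ (proj₁ (point-injective eq))
  injective {inj₂ i} {inj₂ j} eq = cong inj₂ (proj₁ (point-injective eq))
  injective {inj₁ i} {inj₂ j} eq with () ← proj₂ (point-injective eq)
  injective {inj₂ i} {inj₁ j} eq with () ← proj₂ (point-injective eq)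

record TwinPairing {N K} (u : Fin K → F2^ N) : Set where
  field
    point            : Fin K → Bool → Bool → F2^ N
    point-injective  : ∀ {k t b k′ t′ b′} → point k t b ≡ point k′ t′ b′ → k ≡ k′ × t ≡ t′ × b ≡ b′
    point-difference : ∀ k t → point k t false ⊕ point k t true ≡ u k

half : ∀ K → Fin (2 * K) → Fin K × Fin 2
half K i = remQuot {K} 2 (cast (*-comm 2 K) i)

toℕ-half : ∀ K i → toℕ i ≡ 2 * toℕ (proj₁ (half K i)) + toℕ (proj₂ (half K i))
toℕ-half K i = begin
  toℕ i                                  ≡⟨ sym (toℕ-cast (*-comm 2 K) i) ⟩
  toℕ (cast (*-comm 2 K) i)              ≡⟨ cong toℕ (sym (combine-remQuot {K} 2 (cast (*-comm 2 K) i))) ⟩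
  toℕ (combine (proj₁ (half K i)) (proj₂ (half K i)))  ≡⟨ toℕ-combine (proj₁ (half K i)) (proj₂ (half K i)) ⟩
  2 * toℕ (proj₁ (half K i)) + toℕ (proj₂ (half K i))  ∎
  where open ≡-Reasoning

half-injective : ∀ K {i j} → half K i ≡ half K j → i ≡ j
half-injective K {i} {j} eq =
  toℕ-injective (trans (toℕ-half K i) (trans (cong (λ p → 2 * toℕ (proj₁ p) + toℕ (proj₂ p)) eq) (sym (toℕ-half K j))))

even : ∀ {K} → Fin K → Fin (2 * K)
even {K} k = cast (*-comm K 2) (combine k zero)

toℕ-even : ∀ {K} (k : Fin K) → toℕ (even k) ≡ 2 * toℕ k
toℕ-even {K} k = trans (toℕ-cast (*-comm K 2) (combine k zero)) (trans (toℕ-combine k zero) (+-identityʳ _))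

ConsecutivePairs : ∀ {A : Set} K → (Fin (2 * K) → A) → Set
ConsecutivePairs K v = ∀ k → k < K → (i j : Fin (2 * K)) → toℕ i ≡ 2 * k → toℕ j ≡ 2 * k + 1 → v i ≡ v j

paired-value : ∀ {A : Set} {K} (v : Fin (2 * K) → A) → ConsecutivePairs K v → ∀ i → v i ≡ v (even (proj₁ (half K i)))
paired-value {K = K} v pairs i = by-parity (proj₂ (half K i)) (toℕ-half K i)
  where
  k : Fin K
  k = proj₁ (half K i)
  by-parity : ∀ t → toℕ i ≡ 2 * toℕ k + toℕ t → v i ≡ v (even k)
  by-parity zero       i≡2k   = cong v (toℕ-injective (trans i≡2k (trans (+-identityʳ _) (sym (toℕ-even k)))))
  by-parity (suc zero) i≡2k+1 = sym (pairs (toℕ k) (toℕ<n k) (even k) i (toℕ-even k) i≡2k+1)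

pairing-from-twins : ∀ {N K} (y : Fin (2 * K) → F2^ N) (u : Fin K → F2^ N) →
                     (∀ i → y i ≡ u (proj₁ (half K i))) → TwinPairing u → Pairing y
pairing-from-twins {N} {K} y u y≡u T = record
  { point            = pair-point
  ; point-injective  = injective
  ; point-difference = λ i → trans (point-difference _ _) (sym (y≡u i))
  }
  where
  open TwinPairing T
  pair-point : Fin (2 * K) → Bool → F2^ N
  pair-point i b = point (proj₁ (half K i)) (unbit (proj₂ (half K i))) b
  injective : ∀ {i b j c} → pair-point i b ≡ pair-point j c → i ≡ j × b ≡ c
  injective eq with point-injective eq
  ... | k≡k′ , t≡t′ , b≡c = half-injective K (cong₂ _,_ k≡k′ (unbit-injective t≡t′)) , b≡c

-- Rank one: if every y i is supported on the first coordinate, then y i = (1,0,…,0) and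
-- the pairs {(0,x), (1,x)} for x ∈ 𝔽₂ᵉ realise y.
pairing-rank-one : ∀ {e} (y : Fin (2 ^ e) → F2^ (suc e)) → (∀ i → y i ≢ 𝟎) → (∀ i → Supported 1 (y i)) → Pairing y
pairing-rank-one {e} y y≢𝟎 y-supported = record
  { point            = λ i b → b ∷ decode {e} i
  ; point-injective  = λ eq → decode-injective (proj₂ (∷-injective eq)) , proj₁ (∷-injective eq)
  ; point-difference = λ i → trans (cong (true ∷_) (⊕-self (decode {e} i))) (sym (first-unit-vector (y i) (y≢𝟎 i) (y-supported i)))
  }
  where
  first-unit-vector : (x : F2^ (suc e)) → x ≢ 𝟎 → Supported 1 x → x ≡ true ∷ 𝟎
  first-unit-vector (a ∷ x) x≢𝟎 sx with Supported-zero {x = x} (λ i _ → sx (suc i) (s≤s z≤n))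
  first-unit-vector (true  ∷ x) x≢𝟎 sx | refl = refl
  first-unit-vector (false ∷ x) x≢𝟎 sx | refl = ⊥-elim (x≢𝟎 refl)

when : ∀ {p} {P : Set p} → Dec P → ℕ → ℕ
when d c = if does d then c else 0

when-yes : ∀ {p} {P : Set p} {c} → P → (d : Dec P) → when d c ≡ c
when-yes x (yes _) = refl
when-yes x (no ¬x) = ⊥-elim (¬x x)

when-no : ∀ {p} {P : Set p} {c} → ¬ P → (d : Dec P) → when d c ≡ 0
when-no ¬x (yes x) = ⊥-elim (¬x x)
when-no ¬x (no _)  = refl

when-mono : ∀ {p q} {P : Set p} {Q : Set q} {c} → (P → Q) → (d : Dec P) (e : Dec Q) → when d c ≤ when e c
when-mono P⇒Q (yes x) e = ≤-reflexive (sym (when-yes (P⇒Q x) e))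
when-mono P⇒Q (no _)  e = z≤n

when-no<when-yes : ∀ {p q} {P : Set p} {Q : Set q} → ¬ P → Q → (d : Dec P) (e : Dec Q) → when d 1 < when e 1
when-no<when-yes ¬p q d e = subst₂ _<_ (sym (when-no ¬p d)) (sym (when-yes q e)) z<s

when-< : ∀ {p} {P : Set p} {r c} (d : Dec P) → r < when d c → P × r < c
when-< (yes x) r<c = x , r<c

sum-zero : ∀ n → sum {n} (λ _ → 0) ≡ 0
sum-zero zero    = refl
sum-zero (suc n) = sum-zero n

sum-ones : ∀ n → sum {n} (λ _ → 1) ≡ n
sum-ones zero    = refl
sum-ones (suc n) = cong suc (sum-ones n)

sum-mono : ∀ {n} {f g : Fin n → ℕ} → (∀ i → f i ≤ g i) → sum f ≤ sum g
sum-mono {zero}  _   = z≤n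
sum-mono {suc n} f≤g = +-mono-≤ (f≤g zero) (sum-mono (λ i → f≤g (suc i)))

sum-mono-< : ∀ {n} {f g : Fin n → ℕ} → (∀ i → f i ≤ g i) → ∀ i₀ → f i₀ < g i₀ → sum f < sum g
sum-mono-< f≤g zero    f<g = +-mono-<-≤ f<g (sum-mono (λ i → f≤g (suc i)))
sum-mono-< f≤g (suc i) f<g = +-mono-≤-< (f≤g zero) (sum-mono-< (λ i → f≤g (suc i)) i f<g)

term≤sum : ∀ {n} (f : Fin n → ℕ) i → f i ≤ sum f
term≤sum f zero    = m≤m+n _ _
term≤sum f (suc i) = ≤-trans (term≤sum (λ j → f (suc j)) i) (m≤n+m _ _)

sum-point : ∀ {n} (α : Fin n) c → sum (λ x → when (x ≟ᶠ α) c) ≡ c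
sum-point {suc n} zero    c = trans (cong (c +_) (sum-zero n)) (+-identityʳ c)
sum-point {suc n} (suc α) c = sum-point α c

module Occurrences {m V} (val : Fin m → Fin V) where

  count : Fin V → ℕ
  count x = sum (λ j → when (x ≟ᶠ val j) 1)

  count-total : sum count ≡ m
  count-total = begin
    sum (λ x → sum (λ j → when (x ≟ᶠ val j) 1))  ≡⟨ ∑-comm (λ x j → when (x ≟ᶠ val j) 1) ⟩
    sum (λ j → sum (λ x → when (x ≟ᶠ val j) 1))  ≡⟨ sum-cong-≗ (λ j → sum-point (val j) 1) ⟩
    sum {m} (λ _ → 1)                            ≡⟨ sum-ones m ⟩
    m                                            ∎
    where open ≡-Reasoning

  Earlier : Fin m → Fin m → Set
  Earlier k j = toℕ j < toℕ k × val k ≡ val j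

  earlier? : ∀ k j → Dec (Earlier k j)
  earlier? k j = (toℕ j <? toℕ k) ×-dec (val k ≟ᶠ val j)

  rank : Fin m → ℕ
  rank k = sum (λ j → when (earlier? k j) 1)

  -- k itself is counted by count (val k) but not by rank k
  rank<count : ∀ k → rank k < count (val k)
  rank<count k = sum-mono-< (λ j → when-mono proj₂ (earlier? k j) (val k ≟ᶠ val j)) k
    (when-no<when-yes (λ e → <-irrefl refl (proj₁ e)) refl (earlier? k k) (val k ≟ᶠ val k))

  -- a later occurrence of the same value also counts k
  rank-mono : ∀ {k k′} → val k ≡ val k′ → toℕ k < toℕ k′ → rank k < rank k′
  rank-mono {k} {k′} same k<k′ =
    sum-mono-< (λ j → when-mono (λ { (j<k , eq) → <-trans j<k k<k′ , trans (sym same) eq }) (earlier? k j) (earlier? k′ j)) k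
      (when-no<when-yes (λ e → <-irrefl refl (proj₁ e)) (k<k′ , sym same) (earlier? k k) (earlier? k′ k))

  rank-injective : ∀ {k k′} → val k ≡ val k′ → rank k ≡ rank k′ → k ≡ k′
  rank-injective {k} {k′} same r≡r′ with <-cmp (toℕ k) (toℕ k′)
  ... | tri< k<k′ _ _ = ⊥-elim (<-irrefl r≡r′ (rank-mono same k<k′))
  ... | tri≈ _ k≡k′ _ = toℕ-injective k≡k′
  ... | tri> _ _ k>k′ = ⊥-elim (<-irrefl (sym r≡r′) (rank-mono (sym same) k>k′))

record Packing (V G s : ℕ) (cnt : Fin V → ℕ) : Set where
  field
    first second    : Fin G → Fin V
    place           : ∀ x r → r < cnt x → Fin G × Fin s
    place-value     : ∀ x r (r< : r < cnt x) →
                      x ≡ first (proj₁ (place x r r<)) ⊎ x ≡ second (proj₁ (place x r r<))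
    place-injective : ∀ {x r x′ r′} (r< : r < cnt x) (r′< : r′ < cnt x′) →
                      place x r r< ≡ place x′ r′ r′< → x ≡ x′ × r ≡ r′

packing-empty : ∀ {V s} {cnt : Fin V → ℕ} → (∀ x → cnt x ≡ 0) → Packing V 0 s cnt
packing-empty {cnt = cnt} none = record
  { first = λ () ; second = λ ()
  ; place = λ x r r< → ⊥-elim (no-copy x r<)
  ; place-value = λ x r r< → ⊥-elim (no-copy x r<)
  ; place-injective = λ r< _ _ → ⊥-elim (no-copy _ r<) }
  where no-copy : ∀ x {r} → r < cnt x → ⊥
        no-copy x r< with () ← subst (_ <_) (none x) r<

packing-cong : ∀ {V G s} {cnt cnt′ : Fin V → ℕ} → (∀ x → cnt x ≡ cnt′ x) → Packing V G s cnt → Packing V G s cnt′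
packing-cong {cnt = cnt} {cnt′} eq P = record
  { first = first ; second = second
  ; place = λ x r r< → place x r (back r<)
  ; place-value = λ x r r< → place-value x r (back r<)
  ; place-injective = λ r< r′< → place-injective (back r<) (back r′<) }
  where open Packing P
        back : ∀ {x r} → r < cnt′ x → r < cnt x
        back {x} = subst (_ <_) (sym (eq x))

-- Two packings side by side: the bins of the first followed by those of the second.
-- The first c₁ x copies of x go to the first packing, the remaining ones to the second.
packing-stack : ∀ {V G H s} {c₁ c₂ : Fin V → ℕ} → Packing V G s c₁ → Packing V H s c₂ →
                Packing V (G + H) s (λ x → c₁ x + c₂ x)
packing-stack {V} {G} {H} {s} {c₁} {c₂} P₁ P₂ = record
  { first = P₁.first Vector.++ P₂.first
  ; second = P₁.second Vector.++ P₂.second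
  ; place = λ x r r< → placeᴸ (layer x r r<)
  ; place-value = λ x r r< → valueᴸ (layer x r r<)
  ; place-injective = λ r< r′< → injectiveᴸ (layer _ _ r<) (layer _ _ r′<) }
  where
  module P₁ = Packing P₁
  module P₂ = Packing P₂

  data Layer (x : Fin V) (r : ℕ) : Set where
    lower : r < c₁ x → Layer x r
    upper : c₁ x ≤ r → r ∸ c₁ x < c₂ x → Layer x r

  layer : ∀ x r → r < c₁ x + c₂ x → Layer x r
  layer x r r< with r <? c₁ x
  ... | yes r<c₁ = lower r<c₁
  ... | no  r≮c₁ = upper (≮⇒≥ r≮c₁) (+-cancelˡ-< (c₁ x) _ _ (subst (_< c₁ x + c₂ x) (sym (m+[n∸m]≡n (≮⇒≥ r≮c₁))) r<))

  placeᴸ : ∀ {x r} → Layer x r → Fin (G + H) × Fin s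
  placeᴸ {x} {r} (lower r<)   = proj₁ (P₁.place x r r<) ↑ˡ H , proj₂ (P₁.place x r r<)
  placeᴸ {x} {r} (upper _ r<) = G ↑ʳ proj₁ (P₂.place x (r ∸ c₁ x) r<) , proj₂ (P₂.place x (r ∸ c₁ x) r<)

  valueᴸ : ∀ {x r} (l : Layer x r) →
           x ≡ (P₁.first Vector.++ P₂.first) (proj₁ (placeᴸ l)) ⊎ x ≡ (P₁.second Vector.++ P₂.second) (proj₁ (placeᴸ l))
  valueᴸ {x} {r} (lower r<) = Sum.map (λ e → trans e (sym (lookup-++ˡ P₁.first P₂.first _)))
                                      (λ e → trans e (sym (lookup-++ˡ P₁.second P₂.second _))) (P₁.place-value x r r<)
  valueᴸ {x} {r} (upper _ r<) = Sum.map (λ e → trans e (sym (lookup-++ʳ P₁.first P₂.first _)))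
                                        (λ e → trans e (sym (lookup-++ʳ P₁.second P₂.second _))) (P₂.place-value x (r ∸ c₁ x) r<)

  injectiveᴸ : ∀ {x r x′ r′} (l : Layer x r) (l′ : Layer x′ r′) → placeᴸ l ≡ placeᴸ l′ → x ≡ x′ × r ≡ r′
  injectiveᴸ (lower r<) (lower r′<) eq =
    P₁.place-injective r< r′< (cong₂ _,_ (↑ˡ-injective H _ _ (cong proj₁ eq)) (cong proj₂ eq))
  injectiveᴸ (upper c≤r r<) (upper c≤r′ r′<) eq
    with P₂.place-injective r< r′< (cong₂ _,_ (↑ʳ-injective G _ _ (cong proj₁ eq)) (cong proj₂ eq))
  ... | refl , diff≡ = refl , ∸-cancelʳ-≡ c≤r c≤r′ diff≡
  injectiveᴸ (lower _) (upper _ _) eq with () ← trans (sym (splitAt-↑ˡ G _ H)) (trans (cong (splitAt G) (cong proj₁ eq)) (splitAt-↑ʳ G H _))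
  injectiveᴸ (upper _ _) (lower _) eq with () ← trans (sym (splitAt-↑ʳ G H _)) (trans (cong (splitAt G) (cong proj₁ eq)) (splitAt-↑ˡ G _ H))

bin-content : ∀ {V} → Fin V → Fin V → ℕ → ℕ → Fin V → ℕ
bin-content α β a b x = when (x ≟ᶠ α) a + when (x ≟ᶠ β) b

-- The a copies of α fill slots 0 … a−1 and the b copies of β fill slots a … a+b−1.
two-value-bin : ∀ {V s} (α β : Fin V) (a b : ℕ) → a + b ≡ s → Packing V 1 s (bin-content α β a b)
two-value-bin {V} {s} α β a b a+b≡s = record
  { first = λ _ → α ; second = λ _ → β
  ; place = λ x r r< → zero , slot (kind x r r<)
  ; place-value = λ x r r< → value (kind x r r<)
  ; place-injective = λ r< r′< eq → injective (kind _ _ r<) (kind _ _ r′<) (cong proj₂ eq) }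
  where
  data Kind (x : Fin V) (r : ℕ) : Set where
    copy-α : x ≡ α → r < a → Kind x r
    copy-β : x ≡ β → when (x ≟ᶠ α) a ≤ r → r ∸ when (x ≟ᶠ α) a < b → Kind x r

  kind : ∀ x r → r < bin-content α β a b x → Kind x r
  kind x r r< with r <? when (x ≟ᶠ α) a
  ... | yes r<a = copy-α (proj₁ (when-< (x ≟ᶠ α) r<a)) (proj₂ (when-< (x ≟ᶠ α) r<a))
  ... | no  r≮a = copy-β (proj₁ β-copy) (≮⇒≥ r≮a) (proj₂ β-copy)
    where β-copy : x ≡ β × r ∸ when (x ≟ᶠ α) a < b
          β-copy = when-< (x ≟ᶠ β) (+-cancelˡ-< (when (x ≟ᶠ α) a) _ _
                     (subst (_< bin-content α β a b x) (sym (m+[n∸m]≡n (≮⇒≥ r≮a))) r<))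

  slot-index : ∀ {x r} → Kind x r → ℕ
  slot-index {x} {r} (copy-α _ _)   = r
  slot-index {x} {r} (copy-β _ _ _) = a + (r ∸ when (x ≟ᶠ α) a)

  slot-index<s : ∀ {x r} (k : Kind x r) → slot-index k < s
  slot-index<s (copy-α _ r<a)   = subst (_ <_) a+b≡s (<-≤-trans r<a (m≤m+n a b))
  slot-index<s (copy-β _ _ r<b) = subst (_ <_) a+b≡s (+-monoʳ-< a r<b)

  slot : ∀ {x r} → Kind x r → Fin s
  slot k = fromℕ< (slot-index<s k)

  value : ∀ {x r} (k : Kind x r) → x ≡ α ⊎ x ≡ β
  value (copy-α x≡α _)   = inj₁ x≡α
  value (copy-β x≡β _ _) = inj₂ x≡β

  injective : ∀ {x r x′ r′} (k : Kind x r) (k′ : Kind x′ r′) → slot k ≡ slot k′ → x ≡ x′ × r ≡ r′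
  injective k k′ eq = by-bound k k′ (trans (sym (toℕ-fromℕ< (slot-index<s k))) (trans (cong toℕ eq) (toℕ-fromℕ< (slot-index<s k′))))
    where
    by-bound : ∀ {x r x′ r′} (k : Kind x r) (k′ : Kind x′ r′) → slot-index k ≡ slot-index k′ → x ≡ x′ × r ≡ r′
    by-bound (copy-α refl _) (copy-α refl _) r≡r′ = refl , r≡r′
    by-bound (copy-β refl w≤r _) (copy-β refl w≤r′ _) eq = refl , ∸-cancelʳ-≡ w≤r w≤r′ (+-cancelˡ-≡ a _ _ eq)
    by-bound (copy-α _ r<a) (copy-β _ _ _) eq = ⊥-elim (<-irrefl eq (<-≤-trans r<a (m≤m+n a _)))
    by-bound (copy-β _ _ _) (copy-α _ r<a) eq = ⊥-elim (<-irrefl (sym eq) (<-≤-trans r<a (m≤m+n a _)))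

sum-bin-content : ∀ {V} (α β : Fin V) a b → sum (bin-content α β a b) ≡ a + b
sum-bin-content α β a b = trans (∑-distrib-+ (λ x → when (x ≟ᶠ α) a) (λ x → when (x ≟ᶠ β) b))
                                (cong₂ _+_ (sum-point α a) (sum-point β b))

bin-content-≤ : ∀ {V} {cnt : Fin V → ℕ} {α β a b} → (α ≡ β → a + b ≤ cnt α) → a ≤ cnt α → b ≤ cnt β →
                ∀ x → bin-content α β a b x ≤ cnt x
bin-content-≤ {α = α} {β} both a≤ b≤ x with x ≟ᶠ α | x ≟ᶠ β
... | yes refl | yes refl = both refl
... | yes refl | no _     = subst (_≤ _) (sym (+-identityʳ _)) a≤
... | no _     | yes refl = b≤
... | no _     | no _     = z≤n

sgn : ℕ → ℕ
sgn zero    = 0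
sgn (suc _) = 1

occupied : ∀ {V} → (Fin V → ℕ) → ℕ
occupied cnt = sum (λ x → sgn (cnt x))

occupied-≤ : ∀ {V} (cnt : Fin V → ℕ) → occupied cnt ≤ V
occupied-≤ {V} cnt = subst (occupied cnt ≤_) (sum-ones V) (sum-mono {f = λ x → sgn (cnt x)} (λ x → sgn≤1 (cnt x)))
  where sgn≤1 : ∀ c → sgn c ≤ 1
        sgn≤1 zero    = z≤n
        sgn≤1 (suc _) = ≤-refl

sgn-mono : ∀ {c c′} → c′ ≤ c → sgn c′ ≤ sgn c
sgn-mono {c′ = zero}  _         = z≤n
sgn-mono {suc c} {suc c′} _ = ≤-refl

occupied-mono : ∀ {V} {cnt cnt′ : Fin V → ℕ} → (∀ x → cnt′ x ≤ cnt x) → occupied cnt′ ≤ occupied cnt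
occupied-mono le = sum-mono (λ x → sgn-mono (le x))

occupied-drop : ∀ {V} {cnt cnt′ : Fin V → ℕ} → (∀ x → cnt′ x ≤ cnt x) → ∀ x₀ → cnt′ x₀ ≡ 0 → 0 < cnt x₀ →
                occupied cnt′ < occupied cnt
occupied-drop {cnt = cnt} le x₀ emptied occupied₀ = sum-mono-< (λ x → sgn-mono (le x)) x₀ (drop emptied occupied₀)
  where drop : ∀ {c′ c} → c′ ≡ 0 → 0 < c → sgn c′ < sgn c
        drop {c = suc _} refl _ = s≤s z≤n

heavy-exists : ∀ {V s G} {cnt : Fin V → ℕ} → 0 < s → sum cnt ≡ suc G * s → occupied cnt ≤ suc G → Σ (Fin V) λ β → s ≤ cnt β
heavy-exists {V} {suc s′} {G} {cnt} _ total occ with any? (λ x → suc s′ ≤? cnt x)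
... | yes heavy = heavy
... | no  none  = ⊥-elim (<-irrefl refl (begin-strict
    sum cnt                          ≤⟨ sum-mono (λ x → light (cnt x) (≰⇒> (λ h → none (x , h)))) ⟩
    sum (λ x → s′ * sgn (cnt x))     ≡⟨ sym (*-distribˡ-sum s′ (λ x → sgn (cnt x))) ⟩
    s′ * occupied cnt                ≤⟨ *-monoʳ-≤ s′ occ ⟩
    s′ * suc G                       <⟨ *-monoˡ-< (suc G) (n<1+n s′) ⟩
    suc s′ * suc G                   ≡⟨ *-comm (suc s′) (suc G) ⟩
    suc G * suc s′                   ≡⟨ sym total ⟩
    sum cnt                          ∎))
  where
  open ≤-Reasoning
  light : ∀ c → c < suc s′ → c ≤ s′ * sgn c
  light zero    _       = z≤n
  light (suc c) c<s     = subst (suc c ≤_) (sym (*-identityʳ s′)) (≤-pred c<s)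

few-values : ∀ {V s G} {cnt : Fin V → ℕ} → (∀ x → 0 < cnt x → s ≤ cnt x) → ∀ β → s < cnt β →
             sum cnt ≡ suc G * s → occupied cnt ≤ G
few-values {V} {s} {G} {cnt} full β s<β total = ≤-pred (*-cancelˡ-< s _ _ (begin-strict
    s * occupied cnt             ≡⟨ *-distribˡ-sum s (λ x → sgn (cnt x)) ⟩
    sum (λ x → s * sgn (cnt x))  <⟨ sum-mono-< (λ x → weight (cnt x) (full x)) β (overfull (cnt β) s<β) ⟩
    sum cnt                      ≡⟨ total ⟩
    suc G * s                    ≡⟨ *-comm (suc G) s ⟩
    s * suc G                    ∎))
  where
  open ≤-Reasoning
  weight : ∀ c → (0 < c → s ≤ c) → s * sgn c ≤ c
  weight zero    _    = ≤-reflexive (*-zeroʳ s)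
  weight (suc c) full = subst (_≤ suc c) (sym (*-identityʳ s)) (full (s≤s z≤n))
  overfull : ∀ c → s < c → s * sgn c < c
  overfull (suc c) s<c = subst (_< suc c) (sym (*-identityʳ s)) s<c

record BinChoice {V} (s G : ℕ) (cnt : Fin V → ℕ) : Set where
  field
    α β           : Fin V
    a b           : ℕ
    a+b≡s         : a + b ≡ s
    content≤cnt   : ∀ x → bin-content α β a b x ≤ cnt x
    rest-occupied : occupied (λ x → cnt x ∸ bin-content α β a b x) ≤ G

-- Fill the bin with a light value α (0 < cnt α < s), topped up by a heavy value β; if
-- there is no light value, fill it with the heavy value alone.
choose-bin : ∀ {V s G} {cnt : Fin V → ℕ} → 0 < s → sum cnt ≡ suc G * s → occupied cnt ≤ suc G → BinChoice s G cnt
choose-bin {V} {s} {G} {cnt} s>0 total occ with heavy-exists s>0 total occ | any? (λ x → (0 <? cnt x) ×-dec (cnt x <? s))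
... | β , s≤β | yes (α , α>0 , α<s) = record
  { α = α ; β = β ; a = cnt α ; b = s ∸ cnt α
  ; a+b≡s = m+[n∸m]≡n (<⇒≤ α<s)
  ; content≤cnt = fits
  ; rest-occupied = ≤-pred (<-≤-trans (occupied-drop {cnt = cnt} (λ x → m∸n≤m (cnt x) (content x)) α α-emptied α>0) occ) }
  where
  content : Fin V → ℕ
  content = bin-content α β (cnt α) (s ∸ cnt α)
  α≢β : α ≢ β
  α≢β refl = <-irrefl refl (<-≤-trans α<s s≤β)
  fits : ∀ x → content x ≤ cnt x
  fits = bin-content-≤ (λ α≡β → ⊥-elim (α≢β α≡β)) ≤-refl (≤-trans (m∸n≤m s (cnt α)) s≤β)
  α-emptied : cnt α ∸ content α ≡ 0
  α-emptied = m≤n⇒m∸n≡0 (subst (_≤ content α) (when-yes refl (α ≟ᶠ α)) (m≤m+n _ _))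
... | β , s≤β | no no-light = record
  { α = β ; β = β ; a = s ; b = 0
  ; a+b≡s = +-identityʳ s
  ; content≤cnt = fits
  ; rest-occupied = rest-occupied }
  where
  content : Fin V → ℕ
  content = bin-content β β s 0
  fits : ∀ x → content x ≤ cnt x
  fits = bin-content-≤ (λ _ → subst (_≤ cnt β) (sym (+-identityʳ s)) s≤β) s≤β z≤n
  rest≤cnt : ∀ x → cnt x ∸ content x ≤ cnt x
  rest≤cnt x = m∸n≤m (cnt x) (content x)
  s≤content : s ≤ content β
  s≤content = subst (_≤ content β) (when-yes refl (β ≟ᶠ β)) (m≤m+n _ _)
  -- either β is emptied, or β has more than s copies and few-values applies
  rest-occupied : occupied (λ x → cnt x ∸ content x) ≤ G
  rest-occupied with cnt β ≟ s
  ... | yes β≡s = ≤-pred (<-≤-trans (occupied-drop {cnt = cnt} rest≤cnt β β-emptied (<-≤-trans s>0 s≤β)) occ)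
    where β-emptied : cnt β ∸ content β ≡ 0
          β-emptied = m≤n⇒m∸n≡0 (subst (_≤ content β) (sym β≡s) s≤content)
  ... | no  β≢s = ≤-trans (occupied-mono {cnt = cnt} rest≤cnt)
                          (few-values full β (≤∧≢⇒< s≤β (λ e → β≢s (sym e))) total)
    where full : ∀ x → 0 < cnt x → s ≤ cnt x
          full x x>0 = ≮⇒≥ (λ x<s → no-light (x , x>0 , x<s))

-- The alias method (Walker): copies of at most G values, G bins' worth in total, can be
-- packed into G bins of s slots with at most two values per bin.
alias : ∀ {V s} → 0 < s → ∀ G (cnt : Fin V → ℕ) → sum cnt ≡ G * s → occupied cnt ≤ G → Packing V G s cnt
alias s>0 zero    cnt total _ = packing-empty (λ x → n≤0⇒n≡0 (subst (cnt x ≤_) total (term≤sum cnt x)))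
alias {V} {s} s>0 (suc G) cnt total occ =
  packing-cong (λ x → m+[n∸m]≡n (content≤cnt x))
    (packing-stack (two-value-bin α β a b a+b≡s) (alias s>0 G rest rest-total rest-occupied))
  where
  open BinChoice (choose-bin {cnt = cnt} s>0 total occ)
  rest : Fin V → ℕ
  rest x = cnt x ∸ bin-content α β a b x
  rest-total : sum rest ≡ G * s
  rest-total = +-cancelˡ-≡ s _ _ (begin
    s + sum rest                                        ≡⟨ cong (_+ sum rest) (trans (sym a+b≡s) (sym (sum-bin-content α β a b))) ⟩
    sum (bin-content α β a b) + sum rest                ≡⟨ sym (∑-distrib-+ (bin-content α β a b) rest) ⟩
    sum (λ x → bin-content α β a b x + rest x)          ≡⟨ sum-cong-≗ (λ x → m+[n∸m]≡n (content≤cnt x)) ⟩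
    sum cnt                                             ≡⟨ total ⟩
    s + G * s                                           ∎)
    where open ≡-Reasoning

record TwoValueBins {m V} (G s : ℕ) (val : Fin m → Fin V) : Set where
  field
    first second  : Fin G → Fin V
    loc           : Fin m → Fin G × Fin s
    loc-injective : ∀ {k k′} → loc k ≡ loc k′ → k ≡ k′
    loc-value     : ∀ k → val k ≡ first (proj₁ (loc k)) ⊎ val k ≡ second (proj₁ (loc k))

-- The item k is the (rank k)-th copy of its value; the alias method places the copies.
two-value-bins : ∀ {m V G s} → 0 < s → m ≡ G * s → V ≤ G → (val : Fin m → Fin V) → TwoValueBins G s val
two-value-bins {m} {V} {G} {s} s>0 m≡ V≤G val = record
  { first = first ; second = second
  ; loc = λ k → place (val k) (rank k) (rank<count k)
  ; loc-injective = λ {k} {k′} eq → uncurry rank-injective (place-injective (rank<count k) (rank<count k′) eq)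
  ; loc-value = λ k → place-value (val k) (rank k) (rank<count k) }
  where
  open Occurrences val
  open Packing (alias s>0 G count (trans count-total m≡) (≤-trans (occupied-≤ count) V≤G))

-- 𝔽₂² split into two pairs of difference ρ ≠ 0: with η ρ ∉ {0, ρ}, the points
-- t·η ρ ⊕ b·ρ (t, b ∈ 𝔽₂) are all of 𝔽₂², and for fixed t they form a pair of difference ρ.

η : F2^ 2 → F2^ 2
η (true  ∷ _ ∷ []) = false ∷ true ∷ []
η (false ∷ _ ∷ []) = true ∷ false ∷ []

quad : F2^ 2 → Bool → Bool → F2^ 2
quad ρ t b = (t · η ρ) ⊕ (b · ρ)

quad-difference : ∀ ρ t → quad ρ t false ⊕ quad ρ t true ≡ ρ
quad-difference ρ t = pair-difference (t · η ρ) ρ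

-- the coordinates of a vector in the basis (η ρ, ρ)
coordinates : F2^ 2 → F2^ 2 → Bool × Bool
coordinates (false ∷ false ∷ []) _              = false , false
coordinates (false ∷ true  ∷ []) (x₀ ∷ x₁ ∷ []) = x₀ , x₁
coordinates (true  ∷ false ∷ []) (x₀ ∷ x₁ ∷ []) = x₁ , x₀
coordinates (true  ∷ true  ∷ []) (x₀ ∷ x₁ ∷ []) = x₁ xor x₀ , x₀

coordinates-quad : ∀ ρ → ρ ≢ 𝟎 → ∀ t b → coordinates ρ (quad ρ t b) ≡ (t , b)
coordinates-quad (false ∷ false ∷ []) ρ≢𝟎 _ _ = ⊥-elim (ρ≢𝟎 refl)
coordinates-quad (false ∷ true  ∷ []) _ false false = refl
coordinates-quad (false ∷ true  ∷ []) _ false true  = refl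
coordinates-quad (false ∷ true  ∷ []) _ true  false = refl
coordinates-quad (false ∷ true  ∷ []) _ true  true  = refl
coordinates-quad (true  ∷ false ∷ []) _ false false = refl
coordinates-quad (true  ∷ false ∷ []) _ false true  = refl
coordinates-quad (true  ∷ false ∷ []) _ true  false = refl
coordinates-quad (true  ∷ false ∷ []) _ true  true  = refl
coordinates-quad (true  ∷ true  ∷ []) _ false false = refl
coordinates-quad (true  ∷ true  ∷ []) _ false true  = refl
coordinates-quad (true  ∷ true  ∷ []) _ true  false = refl
coordinates-quad (true  ∷ true  ∷ []) _ true  true  = refl

quad-injective : ∀ {ρ} → ρ ≢ 𝟎 → ∀ {t b t′ b′} → quad ρ t b ≡ quad ρ t′ b′ → t ≡ t′ × b ≡ b′
quad-injective {ρ} ρ≢𝟎 {t} {b} {t′} {b′} eq =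
  ,-injective (trans (sym (coordinates-quad ρ ρ≢𝟎 t b)) (trans (cong (coordinates ρ) eq) (coordinates-quad ρ ρ≢𝟎 t′ b′)))

plane-difference : ∀ {d₂ e} (B : LinAut (2 + d₂)) (ρ : F2^ 2) (σ : F2^ d₂) (g : F2^ e) t →
                   (LinAut.from B (quad ρ t false ++ σ) ++ g) ⊕ (LinAut.from B (quad ρ t true ++ σ) ++ g) ≡
                   LinAut.from B (ρ ++ 𝟎) ++ 𝟎
plane-difference B ρ σ g t = begin
  (from B (q false ++ σ) ++ g) ⊕ (from B (q true ++ σ) ++ g)  ≡⟨ ⊕-++ (from B (q false ++ σ)) (from B (q true ++ σ)) g g ⟩
  (from B (q false ++ σ) ⊕ from B (q true ++ σ)) ++ (g ⊕ g)    ≡⟨ cong₂ _++_ (sym (from-⊕ B _ _)) (⊕-self g) ⟩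
  from B ((q false ++ σ) ⊕ (q true ++ σ)) ++ 𝟎                 ≡⟨ cong (λ x → from B x ++ 𝟎) (⊕-++ (q false) (q true) σ σ) ⟩
  from B ((q false ⊕ q true) ++ (σ ⊕ σ)) ++ 𝟎                  ≡⟨ cong (λ x → from B x ++ 𝟎) (cong₂ _++_ (quad-difference ρ t) (⊕-self σ)) ⟩
  from B (ρ ++ 𝟎) ++ 𝟎                                         ∎
  where
  open ≡-Reasoning
  open LinAut using (from)
  open LinAutProperties using (from-⊕)
  q : Bool → F2^ 2
  q = quad ρ t

two : ∀ {N} → F2^ N → F2^ N → Fin 2 → F2^ N
two x y zero       = x
two x y (suc zero) = y

-- Bin g is the fibre 𝔽₂ᵈ × {g}; an automorphism B_g of 𝔽₂ᵈ moves both values of the bin into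
-- 𝔽₂² × 0, and item k in slot σ of bin g receives the four points B_g⁻¹(quad ρ t b ++ σ) ++ g,
-- where B_g (γ k) = ρ ++ 0.
twins-from-bins : ∀ {m} d₂ e (γ : Fin m → F2^ (2 + d₂)) → (∀ k → γ k ≢ 𝟎) →
                  TwoValueBins (2 ^ e) (2 ^ d₂) (λ k → encode (γ k)) → TwinPairing (λ k → γ k ++ 𝟎 {e})
twins-from-bins {m} d₂ e γ γ≢𝟎 bins = record
  { point = point ; point-injective = injective ; point-difference = difference }
  where
  open ≡-Reasoning
  open TwoValueBins bins

  bin : Fin m → Fin (2 ^ e)
  bin k = proj₁ (loc k)

  slot : Fin m → Fin (2 ^ d₂)
  slot k = proj₂ (loc k)

  values : Fin (2 ^ e) → Fin 2 → F2^ (2 + d₂)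
  values g = two (decode (first g)) (decode (second g))

  straightened : ∀ g → Σ (LinAut (2 + d₂)) λ B → ∀ j → Supported 2 (LinAut.to B (values g j))
  straightened g = straighten 2 (values g) (s≤s (s≤s z≤n))

  B : Fin (2 ^ e) → LinAut (2 + d₂)
  B g = proj₁ (straightened g)

  decoded : ∀ k {i : Fin (2 ^ (2 + d₂))} → encode (γ k) ≡ i → decode {2 + d₂} i ≡ γ k
  decoded k refl = decode-encode (γ k)

  -- γ k is one of the two values of its bin, hence moved into 𝔽₂² × 0 by B
  γ-supported : ∀ k → Supported 2 (LinAut.to (B (bin k)) (γ k))
  γ-supported k with loc-value k
  ... | inj₁ γₖ≡first  = subst (λ x → Supported 2 (LinAut.to (B (bin k)) x)) (decoded k γₖ≡first) (proj₂ (straightened (bin k)) zero)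
  ... | inj₂ γₖ≡second = subst (λ x → Supported 2 (LinAut.to (B (bin k)) x)) (decoded k γₖ≡second) (proj₂ (straightened (bin k)) (suc zero))

  ρ : Fin m → F2^ 2
  ρ k = take 2 (LinAut.to (B (bin k)) (γ k))

  ρ-split : ∀ k → LinAut.to (B (bin k)) (γ k) ≡ ρ k ++ 𝟎
  ρ-split k = Supported-split 2 _ (γ-supported k)

  ρ≢𝟎 : ∀ k → ρ k ≢ 𝟎
  ρ≢𝟎 k ρ≡𝟎 = γ≢𝟎 k (to-injective (trans (ρ-split k) (trans (cong (_++ 𝟎) ρ≡𝟎) (trans (𝟎-++ {2} {d₂}) (sym to-𝟎)))))
    where open LinAutProperties (B (bin k))

  plane : Fin m → Bool → Bool → F2^ (2 + d₂)
  plane k t b = LinAut.from (B (bin k)) (quad (ρ k) t b ++ decode {d₂} (slot k))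

  point : Fin m → Bool → Bool → F2^ (2 + d₂ + e)
  point k t b = plane k t b ++ decode {e} (bin k)

  -- a point determines its bin (last e coordinates), then its slot, hence its item
  same-item : ∀ {k t b k′ t′ b′} → point k t b ≡ point k′ t′ b′ → k ≡ k′
  same-item {k} {t} {b} {k′} {t′} {b′} eq = loc-injective (cong₂ _,_ same-bin same-slot)
    where
    same-bin : bin k ≡ bin k′
    same-bin = decode-injective (++-injectiveʳ (plane k t b) (plane k′ t′ b′) eq)
    same-plane : quad (ρ k) t b ++ decode {d₂} (slot k) ≡ quad (ρ k′) t′ b′ ++ decode {d₂} (slot k′)
    same-plane = LinAutProperties.from-injective (B (bin k))
      (trans (++-injectiveˡ (plane k t b) (plane k′ t′ b′) eq) (cong (λ g → LinAut.from (B g) (quad (ρ k′) t′ b′ ++ decode {d₂} (slot k′))) (sym same-bin)))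
    same-slot : slot k ≡ slot k′
    same-slot = decode-injective (++-injectiveʳ (quad (ρ k) t b) (quad (ρ k′) t′ b′) same-plane)

  injective : ∀ {k t b k′ t′ b′} → point k t b ≡ point k′ t′ b′ → k ≡ k′ × t ≡ t′ × b ≡ b′
  injective {k} {t} {b} {k′} {t′} {b′} eq with same-item eq
  ... | refl = refl , quad-injective (ρ≢𝟎 k) (++-injectiveˡ (quad (ρ k) t b) (quad (ρ k) t′ b′)
                 (LinAutProperties.from-injective (B (bin k)) (++-injectiveˡ (plane k t b) (plane k t′ b′) eq)))

  difference : ∀ k t → point k t false ⊕ point k t true ≡ γ k ++ 𝟎
  difference k t = begin
    point k t false ⊕ point k t true                       ≡⟨ plane-difference (B (bin k)) (ρ k) (decode (slot k)) (decode (bin k)) t ⟩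
    LinAut.from (B (bin k)) (ρ k ++ 𝟎) ++ 𝟎                ≡⟨ cong (λ x → LinAut.from (B (bin k)) x ++ 𝟎) (sym (ρ-split k)) ⟩
    LinAut.from (B (bin k)) (LinAut.to (B (bin k)) (γ k)) ++ 𝟎  ≡⟨ cong (_++ 𝟎) (LinAut.from-to (B (bin k)) (γ k)) ⟩
    γ k ++ 𝟎                                               ∎

-- With d ≤ e there are at most 2ᵈ ≤ 2ᵉ values, so the alias method supplies the bins.
twin-pairing : ∀ {m} d₂ e → 2 + d₂ ≤ e → m ≡ 2 ^ e * 2 ^ d₂ →
               (γ : Fin m → F2^ (2 + d₂)) → (∀ k → γ k ≢ 𝟎) → TwinPairing (λ k → γ k ++ 𝟎 {e})
twin-pairing d₂ e d≤e m≡ γ γ≢𝟎 =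
  twins-from-bins d₂ e γ γ≢𝟎 (two-value-bins (m^n>0 2 d₂) m≡ (^-monoʳ-≤ 2 d≤e) (λ k → encode (γ k)))

twins-respect : ∀ {N K} {u u′ : Fin K → F2^ N} → (∀ k → u k ≡ u′ k) → TwinPairing u → TwinPairing u′
twins-respect u≡u′ T = record
  { point = point ; point-injective = point-injective
  ; point-difference = λ k t → trans (point-difference k t) (u≡u′ k) }
  where open TwinPairing T

twin-pairing-supported : ∀ {N m} d₂ e → 2 + d₂ + e ≡ N → 2 + d₂ ≤ e → m ≡ 2 ^ e * 2 ^ d₂ →
                         (u : Fin m → F2^ N) → (∀ k → u k ≢ 𝟎) → (∀ k → Supported (2 + d₂) (u k)) → TwinPairing u
twin-pairing-supported d₂ e refl d≤e m≡ u u≢𝟎 u-supported =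
  twins-respect (λ k → sym (split k)) (twin-pairing d₂ e d≤e m≡ (λ k → take (2 + d₂) (u k)) γ≢𝟎)
  where
  split : ∀ k → u k ≡ take (2 + d₂) (u k) ++ 𝟎
  split k = Supported-split (2 + d₂) (u k) (u-supported k)
  γ≢𝟎 : ∀ k → take (2 + d₂) (u k) ≢ 𝟎
  γ≢𝟎 k γ≡𝟎 = u≢𝟎 k (trans (split k) (trans (cong (_++ 𝟎) γ≡𝟎) (𝟎-++ {2 + d₂} {e})))

split-dimension : ∀ n₂ d₂ → 2 * (2 + d₂) ≤ 2 + n₂ →
                  Σ ℕ λ e → (2 + d₂ + e ≡ 2 + n₂) × (2 + d₂ ≤ e) × (2 ^ n₂ ≡ 2 ^ e * 2 ^ d₂)
split-dimension n₂ d₂ 2d≤n = e , cong (λ x → 2 + x) d₂+e≡n₂ , d≤e , powers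
  where
  d+d≤n : (2 + d₂) + (2 + d₂) ≤ 2 + n₂
  d+d≤n = subst (_≤ 2 + n₂) (cong ((2 + d₂) +_) (+-identityʳ (2 + d₂))) 2d≤n
  d+d₂≤n₂ : 2 + d₂ + d₂ ≤ n₂
  d+d₂≤n₂ = subst (_≤ n₂) (+-comm d₂ (2 + d₂)) (s≤s⁻¹ (s≤s⁻¹ d+d≤n))
  e : ℕ
  e = n₂ ∸ d₂
  d₂+e≡n₂ : d₂ + e ≡ n₂
  d₂+e≡n₂ = m+[n∸m]≡n (m+n≤o⇒m≤o d₂ (subst (_≤ n₂) (+-comm (2 + d₂) d₂) d+d₂≤n₂))
  d≤e : 2 + d₂ ≤ e
  d≤e = m+n≤o⇒m≤o∸n (2 + d₂) d+d₂≤n₂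
  powers : 2 ^ n₂ ≡ 2 ^ e * 2 ^ d₂
  powers = trans (cong (2 ^_) (sym d₂+e≡n₂)) (trans (^-distribˡ-+-* 2 d₂ e) (*-comm (2 ^ d₂) (2 ^ e)))

pairing-of-supported : ∀ n₂ d (y : Fin (2 ^ suc n₂) → F2^ (2 + n₂)) → 2 * d ≤ 2 + n₂ →
                       (∀ i → y i ≢ 𝟎) → (∀ i → Supported d (y i)) → ConsecutivePairs (2 ^ n₂) y → Pairing y
pairing-of-supported n₂ zero y _ y≢𝟎 y-supported _ = ⊥-elim (y≢𝟎 i₀ (Supported-zero (y-supported i₀)))
  where i₀ : Fin (2 ^ suc n₂)
        i₀ = fromℕ< (m^n>0 2 (suc n₂))
pairing-of-supported n₂ 1 y _ y≢𝟎 y-supported _ = pairing-rank-one y y≢𝟎 y-supported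
pairing-of-supported n₂ (suc (suc d₂)) y 2d≤n y≢𝟎 y-supported pairs with split-dimension n₂ d₂ 2d≤n
... | e , n≡d+e , d≤e , powers =
  pairing-from-twins y (λ k → y (even k)) (paired-value y pairs)
    (twin-pairing-supported d₂ e n≡d+e d≤e powers (λ k → y (even k)) (λ k → y≢𝟎 (even k)) (λ k → y-supported (even k)))

proposition7 : (n : ℕ) → 2 ≤ n →
    (v : Fin (2 ^ (n ∸ 1)) → F2^ n) →
    (∀ i → v i ≢ 𝟎) →
    (∀ (k : ℕ) → k < 2 ^ (n ∸ 2) → (i j : Fin (2 ^ (n ∸ 1))) →
    toℕ i ≡ 2 * k → toℕ j ≡ 2 * k + 1 → v i ≡ v j) →
    (Σ ℕ λ d → (2 * d ≤ n) × DimSpan≤ v d) →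
    Σ (Fin (2 ^ (n ∸ 1)) → F2^ n) λ p →
    Σ (Fin (2 ^ (n ∸ 1)) → F2^ n) λ q →
    Bijective _≡_ _≡_ [ p , q ] × (∀ i → p i ⊕ q i ≡ v i)
proposition7 (suc (suc n₂)) (s≤s (s≤s _)) v v≢𝟎 pairs (d , 2d≤n , spanned) =
  (λ i → point i false) , (λ i → point i true) , pairing-bijective M+M≡2ⁿ P , point-difference
  where
  straightened : Σ (LinAut (2 + n₂)) λ A → ∀ i → Supported d (LinAut.to A (v i))
  straightened = straighten-span v spanned (≤-trans (m≤m+n d (d + 0)) 2d≤n)
  A : LinAut (2 + n₂)
  A = proj₁ straightened
  open LinAut A using (to)
  open LinAutProperties A using (to-injective; to-𝟎)
  y : Fin (2 ^ suc n₂) → F2^ (2 + n₂)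
  y i = to (v i)
  y≢𝟎 : ∀ i → y i ≢ 𝟎
  y≢𝟎 i yᵢ≡𝟎 = v≢𝟎 i (to-injective (trans yᵢ≡𝟎 (sym to-𝟎)))
  P : Pairing v
  P = pairing-pullback A v (pairing-of-supported n₂ d y 2d≤n y≢𝟎 (proj₂ straightened)
        (λ k k< i j i≡2k j≡2k+1 → cong to (pairs k k< i j i≡2k j≡2k+1)))
  open Pairing P
  M+M≡2ⁿ : 2 ^ suc n₂ + 2 ^ suc n₂ ≡ 2 ^ (2 + n₂)
  M+M≡2ⁿ = cong (2 ^ suc n₂ +_) (sym (+-identityʳ (2 ^ suc n₂)))
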